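{- For all integers $k\ge 3$ and $r\ge k+2$, $\mathcal M_{2,k}^r\to\mathcal M_{2,k}^{r+2}$.
   Context: $\mathbf{LO}_k^r$ is the $r$-ary structure with domain $[k]=\{1,\dots,k\}$ and relation consisting of all tuples in $[k]^r$ with a unique maximum. For $r$-ary structures $\mathbf{A},\mathbf{B}$, a $p$-ary polymorphism is a function $f: A^p\to B$ such that whenever an $r\times p$ matrix has every column in the relation of $\mathbf A$, applying $f$ to each row yields a tuple in the relation of $\mathbf B$. $\mathrm{Pol}(\mathbf A,\mathbf B)$ is the minion of all polymorphisms with minors $f_\pi(x_1,\dots,x_q)=f(x_{\pi(1)},\dots,x_{\pi(p)})$ for $\pi:[p]\to[q]$. $\mathcal{M}_{2,k}^r = \mathrm{Pol}(\mathbf{LO}_2^r,\mathbf{LO}_k^r)$. A minion homomorphism $\xi:\mathcal M\to\mathcal N$ maps $p$-ary elements to $p$-ary elements with $\xi(f)_\pi=\xi(f_\pi)$ for all $\pi,f$; $\mathcal M\to\mathcal N$ means one exists. -}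

module Defs where

open import Data.Nat using (ℕ)
open import Data.Fin using (Fin; _<_)
open import Data.Product using (Σ; ∃; _,_; proj₁; proj₂)
open import Relation.Binary.PropositionalEquality using (_≡_; _≢_)
open import Function using (_∘_)

Tuple : ℕ → ℕ → Set
Tuple r k = Fin r → Fin k

LO : (k r : ℕ) → Tuple r k → Set
LO k r t = ∃ λ i → ∀ j → j ≢ i → t j < t i

Fun : ℕ → ℕ → ℕ → Set
Fun a b p = (Fin p → Fin a) → Fin b

IsPol : (a b r p : ℕ) → Fun a b p → Set
IsPol a b r p f =
  (M : Fin r → Fin p → Fin a) →
  (∀ c → LO a r (λ i → M i c)) →
  LO b r (λ i → f (M i))

Pol : (a b r p : ℕ) → Set
Pol a b r p = Σ (Fun a b p) (IsPol a b r p)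

minor : ∀ {a b p q} → (Fin p → Fin q) → Fun a b p → Fun a b q
minor π f x = f (x ∘ π)

minor-pol : ∀ {a b r p q} (π : Fin p → Fin q) (f : Fun a b p) →
            IsPol a b r p f → IsPol a b r q (minor π f)
minor-pol π f pf M cols = pf (λ i c → M i (π c)) (λ c → cols (π c))

minorPol : ∀ {a b r p q} → (Fin p → Fin q) → Pol a b r p → Pol a b r q
minorPol π (f , pf) = minor π f , minor-pol π f pf

-- M_{2,k}^r = Pol(LO_2^r, LO_k^r), as a family indexed by arity p.
M2 : (k r p : ℕ) → Set
M2 k r p = Pol 2 k r p

MinionHom : (a b r s : ℕ) → Set
MinionHom a b r s =
  Σ (∀ p → Pol a b r p → Pol a b s p) λ ξ →
    ∀ p q (π : Fin p → Fin q) (f : Pol a b r p) (x : Fin q → Fin a) →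
      proj₁ (ξ q (minorPol π f)) x ≡ proj₁ (minorPol π (ξ p f)) x

-- Every polymorphism f : LO₂ʳ → LOₖʳ is also a polymorphism LO₂ʳ⁺² → LOₖʳ⁺², so the identity
-- is the minion homomorphism.  The columns of an LO₂ matrix are unit vectors.  Suppose f
-- applied to the rows of an (r+2)-row matrix M has a maximum attained at two rows a ≠ b.
-- Replacing two disjoint pairs of rows {x, y} and {z, w}, both avoiding a and b, by their
-- joins gives an r-row matrix with unit columns, on which f has a unique maximum; it must sit
-- at one of the two joined rows.  So f(Mx ∨ My) ≠ f(Mz ∨ Mw), and the larger one exceeds the
-- tie.  Identifying the values 0 and 1 (after choosing the tie well when it is 0) thus turns
-- {x, y} ↦ f(Mx ∨ My) into a colouring of the Kneser graph KG(r, 2) with k − 1 colours,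
-- contradicting χ(KG(r, 2)) = r − 2 ≥ k.
module Submission where

open import Defs
open import Data.Nat as ℕ using (ℕ; zero; suc; _+_; _*_; _≤_; z≤n; s≤s)
import Data.Nat.Properties as ℕ
open import Data.Fin as Fin using (Fin; zero; suc; punchIn; punchOut; pinch; combine; remQuot; _↑ˡ_; _↑ʳ_)
open import Data.Fin.Patterns using (0F; 1F; 2F; 3F; 4F)
open import Data.Fin.Properties
  using (_≟_; any?; all?; ¬Fin0; <-cmp; _<?_; <⇒≢; <-trans; ≤∧≢⇒<; ≤-antisym; ≤-reflexive; ≤-totalOrder;
         injective⇒≤; combine-injective; combine-remQuot; ↑ˡ-injective; ↑ʳ-injective;
         punchIn-injective; punchInᵢ≢i; punchIn-punchOut; punchOut-injective)
open import Data.List using (allFin)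
import Data.List.Extrema
open import Data.List.Membership.Propositional.Properties using (∈-allFin)
import Data.List.Relation.Unary.All as All
open import Data.Vec using (_∷_; []; lookup)
open import Data.Product using (Σ; ∃; ∃₂; _×_; _,_; proj₁; proj₂; swap; uncurry)
open import Data.Sum as Sum using (_⊎_; inj₁; inj₂; [_,_]′)
open import Data.Empty using (⊥; ⊥-elim; ⊥-elim-irr)
open import Function using (_∘_; id)
open import Relation.Binary using (tri<; tri≈; tri>)
open import Relation.Binary.PropositionalEquality
  using (_≡_; _≢_; refl; sym; trans; cong; cong₂; cong-app; subst; subst₂; ≢-sym; module ≡-Reasoning)
open import Relation.Nullary using (¬_; Dec; yes; no)
open import Relation.Nullary.Decidable using (map′; decidable-stable; ¬?; _×-dec_)

noThreeInPair : ∀ {A : Set} {x y v₁ v₂ v₃ : A} → v₁ ≢ v₂ → v₁ ≢ v₃ → v₂ ≢ v₃ →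
                v₁ ≡ x ⊎ v₁ ≡ y → v₂ ≡ x ⊎ v₂ ≡ y → v₃ ≡ x ⊎ v₃ ≡ y → ⊥
noThreeInPair d₁₂ _ _ (inj₁ refl) (inj₁ refl) _ = d₁₂ refl
noThreeInPair d₁₂ _ _ (inj₂ refl) (inj₂ refl) _ = d₁₂ refl
noThreeInPair _ d₁₃ _ (inj₁ refl) _ (inj₁ refl) = d₁₃ refl
noThreeInPair _ d₁₃ _ (inj₂ refl) _ (inj₂ refl) = d₁₃ refl
noThreeInPair _ _ d₂₃ _ (inj₁ refl) (inj₁ refl) = d₂₃ refl
noThreeInPair _ _ d₂₃ _ (inj₂ refl) (inj₂ refl) = d₂₃ refl

fin2-cases : (o : Fin 2) → o ≡ 0F ⊎ o ≡ 1F
fin2-cases 0F = inj₁ refl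
fin2-cases 1F = inj₂ refl

AtMostTwoToOne : ∀ {A B : Set} → (A → B) → Set
AtMostTwoToOne h = ∀ {i j l} → i ≢ j → i ≢ l → j ≢ l → h i ≡ h j → h i ≡ h l → ⊥

∘-atMostTwoToOne : ∀ {A B C : Set} {h : B → C} {g : A → B} →
                   (∀ {i j} → g i ≡ g j → i ≡ j) → AtMostTwoToOne h → AtMostTwoToOne (h ∘ g)
∘-atMostTwoToOne g-injective two d₁₂ d₁₃ d₂₃ =
  two (d₁₂ ∘ g-injective) (d₁₃ ∘ g-injective) (d₂₃ ∘ g-injective)

-- Tagging each i by whether some j < i has the same image makes h injective.
atMostTwoToOne⇒≤ : ∀ {N q} (h : Fin N → Fin q) → AtMostTwoToOne h → N ≤ 2 * q
atMostTwoToOne⇒≤ {N} h two = injective⇒≤ tagged-injective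
  where
  Repeated : Fin N → Set
  Repeated i = ∃ λ j → j Fin.< i × h j ≡ h i

  tag : Fin N → Fin 2
  tag i with any? (λ j → j <? i ×-dec h j ≟ h i)
  ... | yes _ = 1F
  ... | no _ = 0F

  repeated⇒tag : ∀ {i} → Repeated i → tag i ≡ 1F
  repeated⇒tag {i} rep with any? (λ j → j <? i ×-dec h j ≟ h i)
  ... | yes _ = refl
  ... | no none = ⊥-elim (none rep)

  tag⇒repeated : ∀ {i} → tag i ≡ 1F → Repeated i
  tag⇒repeated {i} _ with any? (λ j → j <? i ×-dec h j ≟ h i)
  ... | yes rep = rep

  ¬sameTag : ∀ {i j} → i Fin.< j → tag i ≡ tag j → h i ≡ h j → ⊥
  ¬sameTag {i} {j} i<j same hi≡hj with tag⇒repeated (trans same (repeated⇒tag (i , i<j , hi≡hj)))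
  ... | l , l<i , hl≡hi =
    two (<⇒≢ l<i) (<⇒≢ (<-trans l<i i<j)) (<⇒≢ i<j) hl≡hi (trans hl≡hi hi≡hj)

  tagged-injective : ∀ {i j} → combine (tag i) (h i) ≡ combine (tag j) (h j) → i ≡ j
  tagged-injective {i} {j} e with combine-injective (tag i) (h i) (tag j) (h j) e | <-cmp i j
  ... | same , hi≡hj | tri< i<j _ _ = ⊥-elim (¬sameTag i<j same hi≡hj)
  ... | _            | tri≈ _ i≡j _ = i≡j
  ... | same , hi≡hj | tri> _ _ j<i = ⊥-elim (¬sameTag j<i (sym same) (sym hi≡hj))

∃-∉-image : ∀ {m n} → m ℕ.< n → (xs : Fin m → Fin n) → ∃ λ u → ∀ i → xs i ≢ u
∃-∉-image m<n xs with any? (λ u → all? (λ i → ¬? (xs i ≟ u)))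
... | yes fresh = fresh
... | no noFresh = ⊥-elim (ℕ.<⇒≱ m<n (injective⇒≤ preimage-injective))
  where
  preimage : ∀ u → ∃ λ i → xs i ≡ u
  preimage u = decidable-stable (any? λ i → xs i ≟ u) λ none → noFresh (u , λ i e → none (i , e))
  preimage-injective : ∀ {u v} → proj₁ (preimage u) ≡ proj₁ (preimage v) → u ≡ v
  preimage-injective {u} {v} e = trans (sym (proj₂ (preimage u))) (trans (cong xs e) (proj₂ (preimage v)))

-- The Kneser graph KG(m, 2) needs m − 2 colours

Disjoint : ∀ {m} → Fin m → Fin m → Fin m → Fin m → Set
Disjoint x y z w = x ≢ z × x ≢ w × y ≢ z × y ≢ w

-- Pairs are ordered; the irrelevant argument keeps the colour independent of the proof x ≢ y.
PairColouring : ℕ → ℕ → Set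
PairColouring m q = (x y : Fin m) → .(x ≢ y) → Fin q

IsKneserColouring : ∀ {m q} → PairColouring m q → Set
IsKneserColouring col =
  ∀ {x y z w} (x≢y : x ≢ y) (z≢w : z ≢ w) → Disjoint x y z w → col x y x≢y ≢ col z w z≢w

HasPairAvoiding : ∀ {m q} → PairColouring m q → Fin q → Fin m → Set
HasPairAvoiding col c o = ∃ λ x → ∃ λ y → Σ (x ≢ y) λ x≢y → x ≢ o × y ≢ o × col x y x≢y ≡ c

hasPairAvoiding? : ∀ {m q} (col : PairColouring m q) c o → Dec (HasPairAvoiding col c o)
hasPairAvoiding? col c o = any? λ x → any? λ y → pair? x y
  where
  pair? : ∀ x y → Dec (Σ (x ≢ y) λ x≢y → x ≢ o × y ≢ o × col x y x≢y ≡ c)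
  pair? x y with x ≟ y
  ... | yes refl = no λ (x≢x , _) → x≢x refl
  ... | no x≢y = map′ (x≢y ,_) proj₂ (¬? (x ≟ o) ×-dec ¬? (y ≟ o) ×-dec col x y x≢y ≟ c)

sameColour⇒meet : ∀ {m q} {col : PairColouring m q} → IsKneserColouring col →
                  ∀ {x y o v} (x≢y : x ≢ y) (o≢v : o ≢ v) → x ≢ o → y ≢ o →
                  col x y x≢y ≡ col o v o≢v → v ≡ x ⊎ v ≡ y
sameColour⇒meet proper {x} {y} {o} {v} x≢y o≢v x≢o y≢o same with v ≟ x | v ≟ y
... | yes v≡x | _       = inj₁ v≡x
... | no _    | yes v≡y = inj₂ v≡y
... | no v≢x  | no v≢y  = ⊥-elim (proper x≢y o≢v (x≢o , ≢-sym v≢x , y≢o , ≢-sym v≢y) same)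

deleteVertex : ∀ {m q} (col : PairColouring (suc m) (suc q)) (o : Fin (suc m)) (c : Fin (suc q)) →
               ¬ HasPairAvoiding col c o → PairColouring m q
deleteVertex col o c star x y x≢y = punchOut {i = c} λ c≡ →
  ⊥-elim-irr (star (punchIn o x , punchIn o y , x≢y ∘ punchIn-injective o x y ,
                    punchInᵢ≢i o x , punchInᵢ≢i o y , sym c≡))

deleteVertex-proper : ∀ {m q} {col : PairColouring (suc m) (suc q)} {o c}
                      (star : ¬ HasPairAvoiding col c o) →
                      IsKneserColouring col → IsKneserColouring (deleteVertex col o c star)
deleteVertex-proper {o = o} {c} star proper x≢y z≢w (x≢z , x≢w , y≢z , y≢w) same =
  proper (x≢y ∘ inj) (z≢w ∘ inj) (x≢z ∘ inj , x≢w ∘ inj , y≢z ∘ inj , y≢w ∘ inj)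
         (punchOut-injective {i = c} _ _ same)
  where
  inj : ∀ {u v} → punchIn o u ≡ punchIn o v → u ≡ v
  inj = punchIn-injective o _ _

-- The spokes are the pairs {o, v} with centre o ∈ {0, 1} and leaf v ≥ 2.
module Spokes {n q} {col : PairColouring (2 + n) q} (proper : IsKneserColouring col) where

  centre≢leaf : ∀ (o : Fin 2) (v : Fin n) → o ↑ˡ n ≢ 2 ↑ʳ v
  centre≢leaf 0F _ ()
  centre≢leaf 1F _ ()

  spoke : Fin 2 × Fin n → Fin q
  spoke (o , v) = col (o ↑ˡ n) (2 ↑ʳ v) (centre≢leaf o v)

  spokes-sameCentre : ∀ {o v₁ v₂ v₃} → HasPairAvoiding col (spoke (o , v₁)) (o ↑ˡ n) →
                      v₁ ≢ v₂ → v₁ ≢ v₃ → v₂ ≢ v₃ →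
                      spoke (o , v₁) ≡ spoke (o , v₂) → spoke (o , v₁) ≡ spoke (o , v₃) → ⊥
  spokes-sameCentre {o} {v₁} {v₂} {v₃} (x , y , x≢y , x≢o , y≢o , c) d₁₂ d₁₃ d₂₃ e₁₂ e₁₃ =
    noThreeInPair (d₁₂ ∘ leaf-injective) (d₁₃ ∘ leaf-injective) (d₂₃ ∘ leaf-injective)
      (meet v₁ c) (meet v₂ (trans c e₁₂)) (meet v₃ (trans c e₁₃))
    where
    leaf-injective : ∀ {u v} → 2 ↑ʳ u ≡ 2 ↑ʳ v → u ≡ v
    leaf-injective = ↑ʳ-injective 2 _ _
    meet : ∀ v → col x y x≢y ≡ spoke (o , v) → 2 ↑ʳ v ≡ x ⊎ 2 ↑ʳ v ≡ y
    meet v = sameColour⇒meet proper x≢y (centre≢leaf o v) x≢o y≢o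

  spokes-twoCentres : ∀ {o o′ v u} → o ≢ o′ → spoke (o , v) ≡ spoke (o′ , u) → v ≡ u
  spokes-twoCentres {o} {o′} {v} {u} o≢o′ e
    with sameColour⇒meet proper (centre≢leaf o′ u) (centre≢leaf o v)
           (o≢o′ ∘ ↑ˡ-injective n _ _ ∘ sym) (≢-sym (centre≢leaf o u)) (sym e)
  ... | inj₁ leaf≡centre = ⊥-elim (centre≢leaf o′ v (sym leaf≡centre))
  ... | inj₂ v≡u = ↑ʳ-injective 2 _ _ v≡u

  spoke-atMostTwoToOne : (∀ o c → HasPairAvoiding col c (o ↑ˡ n)) → AtMostTwoToOne spoke
  spoke-atMostTwoToOne avoid {o₁ , v₁} {o₂ , v₂} {o₃ , v₃} d₁₂ d₁₃ d₂₃ e₁₂ e₁₃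
    with o₁ ≟ o₂ | o₁ ≟ o₃ | o₂ ≟ o₃
  ... | yes refl | yes refl | _ =
    spokes-sameCentre (avoid o₁ _) (d₁₂ ∘ cong (o₁ ,_)) (d₁₃ ∘ cong (o₁ ,_)) (d₂₃ ∘ cong (o₁ ,_)) e₁₂ e₁₃
  ... | yes refl | no o₁≢o₃ | _ =
    d₁₂ (cong (o₁ ,_) (trans (spokes-twoCentres o₁≢o₃ e₁₃)
                             (sym (spokes-twoCentres o₁≢o₃ (trans (sym e₁₂) e₁₃)))))
  ... | no o₁≢o₂ | yes refl | _ =
    d₁₃ (cong (o₁ ,_) (trans (spokes-twoCentres o₁≢o₂ e₁₂)
                             (sym (spokes-twoCentres o₁≢o₂ (trans (sym e₁₃) e₁₂)))))
  ... | no o₁≢o₂ | no o₁≢o₃ | yes refl =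
    d₂₃ (cong (o₂ ,_) (trans (sym (spokes-twoCentres o₁≢o₂ e₁₂)) (spokes-twoCentres o₁≢o₃ e₁₃)))
  ... | no o₁≢o₂ | no o₁≢o₃ | no o₂≢o₃ =
    noThreeInPair o₁≢o₂ o₁≢o₃ o₂≢o₃ (fin2-cases o₁) (fin2-cases o₂) (fin2-cases o₃)

  spokes-bound : (∀ o c → HasPairAvoiding col c (o ↑ˡ n)) → n ≤ q
  spokes-bound avoid = ℕ.*-cancelˡ-≤ 2 (atMostTwoToOne⇒≤ (spoke ∘ remQuot n)
    (∘-atMostTwoToOne remQuot-injective (spoke-atMostTwoToOne avoid)))
    where
    remQuot-injective : ∀ {i j} → remQuot {2} n i ≡ remQuot n j → i ≡ j
    remQuot-injective {i} {j} e =
      trans (sym (combine-remQuot n i)) (trans (cong (uncurry combine) e) (combine-remQuot n j))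

-- If some colour class is a star, delete its centre together with that colour; otherwise
-- every colour occurs at most twice among the spokes.
kneser : ∀ {m q} (col : PairColouring m q) → IsKneserColouring col → m ≤ 2 + q
kneser {zero} _ _ = z≤n
kneser {suc zero} _ _ = s≤s z≤n
kneser {suc (suc n)} {zero} col _ = ⊥-elim (¬Fin0 (col 0F 1F λ ()))
kneser {suc (suc n)} {suc q} col proper with any? (λ o → any? (λ c → ¬? (hasPairAvoiding? col c o)))
... | yes (o , c , star) = s≤s (kneser (deleteVertex col o c star) (deleteVertex-proper star proper))
... | no noStar = s≤s (s≤s (Spokes.spokes-bound proper λ o c →
  decidable-stable (hasPairAvoiding? col c (o ↑ˡ n)) λ star → noStar (o ↑ˡ n , c , star)))

maximum : ∀ {n k} (v : Fin (suc n) → Fin k) → ∃ λ a → ∀ j → v j Fin.≤ v a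
maximum {k = k} v =
  argmax v 0F (allFin _) , λ j → All.lookup (f[xs]≤f[argmax] {f = v} 0F (allFin _)) (∈-allFin j)
  where open Data.List.Extrema (≤-totalOrder k)

TiedMaximum : ∀ {n k} → (Fin n → Fin k) → Fin n → Fin n → Set
TiedMaximum v a b = a ≢ b × v b ≡ v a × (∀ j → v j Fin.≤ v a)

LO⊎tiedMaximum : ∀ {n k} (v : Fin (suc n) → Fin k) → LO k (suc n) v ⊎ ∃₂ (TiedMaximum v)
LO⊎tiedMaximum v with maximum v
... | a , max with any? (λ b → ¬? (b ≟ a) ×-dec (v b ≟ v a))
... | yes (b , b≢a , tie) = inj₂ (a , b , ≢-sym b≢a , tie , max)
... | no noTie = inj₁ (a , λ j j≢a → ≤∧≢⇒< (max j) λ tie → noTie (j , j≢a , tie))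

tied<LO : ∀ {n k} {v : Fin n → Fin k} (lo : LO k n v) {i j} → i ≢ j → v i ≡ v j → v i Fin.< v (proj₁ lo)
tied<LO {v = v} (ι , above) {i} {j} i≢j tie with i ≟ ι
... | no i≢ι = above i i≢ι
... | yes refl = subst (Fin._< v ι) (sym tie) (above j (≢-sym i≢j))

LO-separates : ∀ {n k} {v : Fin n → Fin k} {A X Z : Fin k} {i₁ i₂ j₁ j₂} → LO k n v →
               i₁ ≢ i₂ → v i₁ ≡ A → v i₂ ≡ A → j₁ ≢ j₂ → v j₁ ≡ X → v j₂ ≡ Z →
               (∀ l → v l Fin.≤ A ⊎ v l ≡ X ⊎ v l ≡ Z) → X ≢ Z × (A Fin.< X ⊎ A Fin.< Z)
LO-separates {v = v} {A} {X} {Z} lo@(ι , _) i₁≢i₂ vi₁ vi₂ j₁≢j₂ vj₁ vj₂ bounded =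
  separated top , above top
  where
  A<top : A Fin.< v ι
  A<top = subst (Fin._< v ι) vi₁ (tied<LO lo i₁≢i₂ (trans vi₁ (sym vi₂)))
  top : v ι ≡ X ⊎ v ι ≡ Z
  top with bounded ι
  ... | inj₁ top≤A = ⊥-elim (ℕ.<⇒≱ A<top top≤A)
  ... | inj₂ top≡ = top≡
  above : v ι ≡ X ⊎ v ι ≡ Z → A Fin.< X ⊎ A Fin.< Z
  above (inj₁ refl) = inj₁ A<top
  above (inj₂ refl) = inj₂ A<top
  separated : v ι ≡ X ⊎ v ι ≡ Z → X ≢ Z
  separated top X≡Z = ℕ.<-irrefl (cong Fin.toℕ (trans vj₁ (sym ι≡X)))
    (tied<LO lo j₁≢j₂ (trans vj₁ (trans X≡Z (sym vj₂))))
    where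
    ι≡X : v ι ≡ X
    ι≡X = [ id , (λ ι≡Z → trans ι≡Z (sym X≡Z)) ]′ top

-- Merging rows of a matrix with unit columns

IsUnit : ∀ {n} → (Fin n → Fin 2) → Set
IsUnit v = ∃ λ t → v t ≡ 1F × ∀ j → j ≢ t → v j ≡ 0F

unit⇒LO : ∀ {n} {v : Fin n → Fin 2} → IsUnit v → LO 2 n v
unit⇒LO (t , vt≡1 , v≡0) = t , λ j j≢t → subst₂ Fin._<_ (sym (v≡0 j j≢t)) (sym vt≡1) (s≤s z≤n)

LO⇒unit : ∀ {n} {v : Fin (suc (suc n)) → Fin 2} → LO 2 (suc (suc n)) v → IsUnit v
LO⇒unit {v = v} (t , above) = t , proj₂ (bits _ (proj₂ (other t))) , λ j j≢t → proj₁ (bits j j≢t)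
  where
  bits : ∀ j → j ≢ t → v j ≡ 0F × v t ≡ 1F
  bits j j≢t with v j | v t | above j j≢t
  ... | 0F | 1F | _ = refl , refl
  ... | 1F | 1F | s≤s ()
  other : ∀ t → ∃ λ j → j ≢ t
  other zero = 1F , λ ()
  other (suc _) = 0F , λ ()

Row : ℕ → Set
Row p = Fin p → Fin 2

_∨₂_ : Fin 2 → Fin 2 → Fin 2
0F ∨₂ b = b
1F ∨₂ _ = 1F

_∨ᵣ_ : ∀ {p} → Row p → Row p → Row p
(u ∨ᵣ v) c = u c ∨₂ v c

fuse : ∀ {n p} → Fin n → Fin n → (Fin n → Row p) → Fin n → Row p
fuse x y M t with t ≟ x
... | yes _ = M x ∨ᵣ M y
... | no _ = M t

module _ {n p} {x y : Fin n} {M : Fin n → Row p} where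

  fuse-≡ : fuse x y M x ≡ M x ∨ᵣ M y
  fuse-≡ with x ≟ x
  ... | yes _ = refl
  ... | no x≢x = ⊥-elim (x≢x refl)

  fuse-≢ : ∀ {t} → t ≢ x → fuse x y M t ≡ M t
  fuse-≢ {t} t≢x with t ≟ x
  ... | yes t≡x = ⊥-elim (t≢x t≡x)
  ... | no _ = refl

  fuse-cases : ∀ t → fuse x y M t ≡ M x ∨ᵣ M y ⊎ fuse x y M t ≡ M t
  fuse-cases t with t ≟ x
  ... | yes _ = inj₁ refl
  ... | no _ = inj₂ refl

merge : ∀ {n p} → (x y : Fin (suc n)) → (Fin (suc n) → Row p) → Fin n → Row p
merge x y M = fuse x y M ∘ punchIn y

punchIn-≢ : ∀ {n} {y t : Fin (suc n)} {y≢t : y ≢ t} {i} → i ≢ punchOut y≢t → punchIn y i ≢ t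
punchIn-≢ {y = y} {y≢t = y≢t} {i} i≢ e = i≢ (punchIn-injective y i _ (trans e (sym (punchIn-punchOut y≢t))))

module _ {n p} {x y : Fin (suc n)} {M : Fin (suc n) → Row p} where

  merge-punchOut : ∀ {t} (y≢t : y ≢ t) → merge x y M (punchOut y≢t) ≡ fuse x y M t
  merge-punchOut y≢t = cong (fuse x y M) (punchIn-punchOut y≢t)

  merge-cases : ∀ i → merge x y M i ≡ M x ∨ᵣ M y ⊎ ∃ λ t → merge x y M i ≡ M t
  merge-cases i with fuse-cases {x = x} {y} {M} (punchIn y i)
  ... | inj₁ joined = inj₁ joined
  ... | inj₂ kept = inj₂ (punchIn y i , kept)

  merge-unit : x ≢ y → ∀ c → IsUnit (λ j → M j c) → IsUnit (λ i → merge x y M i c)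
  merge-unit x≢y c (t , Mt≡1 , M≡0) with t ≟ y
  ... | yes refl = punchOut y≢x , top , rest
    where
    open ≡-Reasoning
    y≢x = ≢-sym x≢y
    top : merge x y M (punchOut y≢x) c ≡ 1F
    top = begin
      merge x y M (punchOut y≢x) c  ≡⟨ cong-app (merge-punchOut y≢x) c ⟩
      fuse x y M x c                ≡⟨ cong-app (fuse-≡ {x = x} {y} {M}) c ⟩
      M x c ∨₂ M y c                ≡⟨ cong₂ _∨₂_ (M≡0 x x≢y) Mt≡1 ⟩
      1F                            ∎
    rest : ∀ i → i ≢ punchOut y≢x → merge x y M i c ≡ 0F
    rest i i≢ = trans (cong-app (fuse-≢ {x = x} {y} {M} (punchIn-≢ {y = y} i≢)) c) (M≡0 _ (punchInᵢ≢i y i))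
  ... | no t≢y = punchOut (≢-sym t≢y) , trans (cong-app (merge-punchOut (≢-sym t≢y)) c) top , rest
    where
    top : fuse x y M t c ≡ 1F
    top with t ≟ x
    ... | yes refl = cong (_∨₂ M y c) Mt≡1
    ... | no _ = Mt≡1
    rest : ∀ i → i ≢ punchOut (≢-sym t≢y) → merge x y M i c ≡ 0F
    rest i i≢ with punchIn y i ≟ x
    ... | yes refl = cong₂ _∨₂_ (M≡0 _ (punchIn-≢ i≢)) (M≡0 y (≢-sym t≢y))
    ... | no _ = M≡0 _ (punchIn-≢ i≢)

module DoubleMerge {r p} (M : Fin (2 + r) → Row p) {x y z w : Fin (2 + r)}
                   (x≢y : x ≢ y) (z≢w : z ≢ w) (disjoint : Disjoint x y z w) where

  open ≡-Reasoning

  private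
    x≢z = proj₁ disjoint
    x≢w = proj₁ (proj₂ disjoint)
    y≢z = proj₁ (proj₂ (proj₂ disjoint))
    y≢w = proj₂ (proj₂ (proj₂ disjoint))
    M₁ = merge x y M
    z′ = punchOut y≢z
    w′ = punchOut y≢w

  doubleMerge : Fin r → Row p
  doubleMerge = merge z′ w′ M₁

  position : ∀ t → y ≢ t → w ≢ t → Fin r
  position t y≢t w≢t = punchOut {i = w′} (w≢t ∘ punchOut-injective y≢w y≢t)

  position-≢ : ∀ {t s} (y≢t : y ≢ t) (w≢t : w ≢ t) (y≢s : y ≢ s) (w≢s : w ≢ s) →
               t ≢ s → position t y≢t w≢t ≢ position s y≢s w≢s
  position-≢ y≢t _ y≢s _ t≢s = t≢s ∘ punchOut-injective y≢t y≢s ∘ punchOut-injective {i = w′} _ _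

  position-xy position-zw : Fin r
  position-xy = position x (≢-sym x≢y) (≢-sym x≢w)
  position-zw = position z y≢z (≢-sym z≢w)

  position-xy≢position-zw : position-xy ≢ position-zw
  position-xy≢position-zw = position-≢ (≢-sym x≢y) (≢-sym x≢w) y≢z (≢-sym z≢w) x≢z

  private
    at-position : ∀ {t} (y≢t : y ≢ t) (w≢t : w ≢ t) →
                  doubleMerge (position t y≢t w≢t) ≡ fuse z′ w′ M₁ (punchOut y≢t)
    at-position y≢t w≢t = merge-punchOut {x = z′} {w′} {M₁} (w≢t ∘ punchOut-injective y≢w y≢t)

    kept : ∀ {t} (y≢t : y ≢ t) → t ≢ x → M₁ (punchOut y≢t) ≡ M t
    kept y≢t t≢x = trans (merge-punchOut {x = x} {y} {M} y≢t) (fuse-≢ {x = x} {y} {M} t≢x)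

    merged-zw : M₁ z′ ∨ᵣ M₁ w′ ≡ M z ∨ᵣ M w
    merged-zw = cong₂ _∨ᵣ_ (kept y≢z (≢-sym x≢z)) (kept y≢w (≢-sym x≢w))

  at-xy : doubleMerge position-xy ≡ M x ∨ᵣ M y
  at-xy = begin
    doubleMerge position-xy       ≡⟨ at-position y≢x (≢-sym x≢w) ⟩
    fuse z′ w′ M₁ (punchOut y≢x)  ≡⟨ fuse-≢ {x = z′} {w′} {M₁} (x≢z ∘ punchOut-injective y≢x y≢z) ⟩
    M₁ (punchOut y≢x)             ≡⟨ merge-punchOut {x = x} {y} {M} y≢x ⟩
    fuse x y M x                  ≡⟨ fuse-≡ {x = x} {y} {M} ⟩
    M x ∨ᵣ M y                    ∎
    where
    y≢x = ≢-sym x≢y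

  at-zw : doubleMerge position-zw ≡ M z ∨ᵣ M w
  at-zw = begin
    doubleMerge position-zw  ≡⟨ at-position y≢z (≢-sym z≢w) ⟩
    fuse z′ w′ M₁ z′         ≡⟨ fuse-≡ {x = z′} {w′} {M₁} ⟩
    M₁ z′ ∨ᵣ M₁ w′           ≡⟨ merged-zw ⟩
    M z ∨ᵣ M w               ∎

  at-other : ∀ {t} (y≢t : y ≢ t) (w≢t : w ≢ t) → t ≢ x → t ≢ z → doubleMerge (position t y≢t w≢t) ≡ M t
  at-other {t} y≢t w≢t t≢x t≢z = begin
    doubleMerge (position t y≢t w≢t)  ≡⟨ at-position y≢t w≢t ⟩
    fuse z′ w′ M₁ (punchOut y≢t)      ≡⟨ fuse-≢ {x = z′} {w′} {M₁} (t≢z ∘ punchOut-injective y≢t y≢z) ⟩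
    M₁ (punchOut y≢t)                 ≡⟨ kept y≢t t≢x ⟩
    M t                               ∎

  doubleMerge-cases : ∀ i → doubleMerge i ≡ M x ∨ᵣ M y ⊎ doubleMerge i ≡ M z ∨ᵣ M w ⊎
                            ∃ λ t → doubleMerge i ≡ M t
  doubleMerge-cases i with merge-cases {x = z′} {w′} {M₁} i
  ... | inj₁ e = inj₂ (inj₁ (trans e merged-zw))
  ... | inj₂ (t′ , e) with merge-cases {x = x} {y} {M} t′
  ... | inj₁ e′ = inj₁ (trans e e′)
  ... | inj₂ (t , e′) = inj₂ (inj₂ (t , trans e e′))

  doubleMerge-unit : (∀ c → IsUnit (λ j → M j c)) → ∀ c → IsUnit (λ i → doubleMerge i c)
  doubleMerge-unit unit c =
    merge-unit (z≢w ∘ punchOut-injective y≢z y≢w) c (merge-unit x≢y c (unit c))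

-- Extending a polymorphism by two rows

-- pinch 0F identifies the values 0 and 1.
pinch-separates : ∀ {k} {A X Z : Fin (suc (suc k))} → X ≢ Z → A Fin.< X ⊎ A Fin.< Z →
                  A ≢ 0F ⊎ X ≢ 0F × Z ≢ 0F → pinch 0F X ≢ pinch 0F Z
pinch-separates {X = 0F} {0F} X≢Z _ _ _ = X≢Z refl
pinch-separates {X = 0F} {1F} _ above nonzero _ = zeroOne above nonzero
  where
  zeroOne : ∀ {k} {A : Fin (suc (suc k))} {P : Set} →
            A Fin.< Fin.zero {suc k} ⊎ A Fin.< Fin.suc (Fin.zero {k}) → A ≢ 0F ⊎ Fin.zero {suc k} ≢ 0F × P → ⊥
  zeroOne _ (inj₂ (0≢0 , _)) = 0≢0 refl
  zeroOne {A = zero} _ (inj₁ A≢0) = A≢0 refl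
  zeroOne {A = suc _} (inj₁ ()) _
  zeroOne {A = suc _} (inj₂ (s≤s ())) _
pinch-separates {X = 1F} {0F} X≢Z above nonzero =
  pinch-separates (X≢Z ∘ sym) (Sum.swap above) (Sum.map₂ swap nonzero) ∘ sym
pinch-separates {X = 0F} {suc (suc _)} _ _ _ ()
pinch-separates {X = suc (suc _)} {0F} _ _ _ ()
pinch-separates {X = suc _} {suc _} X≢Z _ _ e = X≢Z (cong suc e)

module Extension {k r p} (f : Fun 2 (2 + k) p) (pol : IsPol 2 (2 + k) r p f)
                 (M : Fin (2 + r) → Row p) (unit : ∀ c → IsUnit (λ j → M j c))
                 (r-large : 3 + k ℕ.< r) where

  value : Fin (2 + r) → Fin (2 + k)
  value j = f (M j)

  pairValue : Fin (2 + r) → Fin (2 + r) → Fin (2 + k)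
  pairValue x y = f (M x ∨ᵣ M y)

  merging-separates : ∀ {a b x y z w} → TiedMaximum value a b → (x≢y : x ≢ y) (z≢w : z ≢ w) →
                      Disjoint x y z w → Disjoint a b x y → Disjoint a b z w →
                      pairValue x y ≢ pairValue z w × (value a Fin.< pairValue x y ⊎ value a Fin.< pairValue z w)
  merging-separates {a} {b} {x} {y} {z} {w} (a≢b , tie , max) x≢y z≢w disjoint
                    (a≢x , a≢y , b≢x , b≢y) (a≢z , a≢w , b≢z , b≢w) =
    LO-separates {v = f ∘ doubleMerge} {value a} {pairValue x y} {pairValue z w}
                 {position-a} {position-b} {position-xy} {position-zw}
      (pol doubleMerge (λ c → unit⇒LO (doubleMerge-unit unit c)))
      (position-≢ (≢-sym a≢y) (≢-sym a≢w) (≢-sym b≢y) (≢-sym b≢w) a≢b)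
      (cong f (at-other (≢-sym a≢y) (≢-sym a≢w) a≢x a≢z))
      (trans (cong f (at-other (≢-sym b≢y) (≢-sym b≢w) b≢x b≢z)) tie)
      position-xy≢position-zw (cong f at-xy) (cong f at-zw) bounded
    where
    open DoubleMerge M x≢y z≢w disjoint
    position-a = position a (≢-sym a≢y) (≢-sym a≢w)
    position-b = position b (≢-sym b≢y) (≢-sym b≢w)
    bounded : ∀ i → f (doubleMerge i) Fin.≤ value a ⊎ f (doubleMerge i) ≡ pairValue x y ⊎
                    f (doubleMerge i) ≡ pairValue z w
    bounded i with doubleMerge-cases i
    ... | inj₁ e = inj₂ (inj₁ (cong f e))
    ... | inj₂ (inj₁ e) = inj₂ (inj₂ (cong f e))
    ... | inj₂ (inj₂ (t , e)) = inj₁ (subst (Fin._≤ value a) (cong f (sym e)) (max t))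

  Separating : Fin (2 + r) → Fin (2 + r) → Set
  Separating a b = ∀ {x y z w} (x≢y : x ≢ y) (z≢w : z ≢ w) →
                   Disjoint x y z w → Disjoint a b x y → Disjoint a b z w →
                   pinch 0F (pairValue x y) ≢ pinch 0F (pairValue z w)

  ¬separating : ∀ {a b} → a ≢ b → ¬ Separating a b
  ¬separating {a} {b} a≢b separating = ℕ.<⇒≱ r-large (kneser colour proper)
    where
    b′ = punchOut a≢b
    E : Fin r → Fin (2 + r)
    E = punchIn a ∘ punchIn b′
    E-injective : ∀ {u v} → E u ≡ E v → u ≡ v
    E-injective = punchIn-injective b′ _ _ ∘ punchIn-injective a _ _
    a≢E : ∀ u → a ≢ E u
    a≢E u = ≢-sym (punchInᵢ≢i a _)
    b≢E : ∀ u → b ≢ E u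
    b≢E u b≡E = punchInᵢ≢i b′ u (punchIn-injective a _ _ (trans (sym b≡E) (sym (punchIn-punchOut a≢b))))
    colour : PairColouring r (suc k)
    colour u v _ = pinch 0F (pairValue (E u) (E v))
    proper : IsKneserColouring colour
    proper {u} {v} {s} {t} u≢v s≢t (u≢s , u≢t , v≢s , v≢t) =
      separating (u≢v ∘ E-injective) (s≢t ∘ E-injective)
        (u≢s ∘ E-injective , u≢t ∘ E-injective , v≢s ∘ E-injective , v≢t ∘ E-injective)
        (a≢E u , a≢E v , b≢E u , b≢E v) (a≢E s , a≢E t , b≢E s , b≢E t)

  tied⇒separating : ∀ {a b} → TiedMaximum value a b →
                    value a ≢ 0F ⊎ (∀ {x y} → x ≢ y → Disjoint a b x y → pairValue x y ≢ 0F) →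
                    Separating a b
  tied⇒separating tie nonzero x≢y z≢w disjoint ab-xy ab-zw
    with merging-separates tie x≢y z≢w disjoint ab-xy ab-zw
  ... | separated , above =
    pinch-separates separated above (Sum.map₂ (λ nz → nz x≢y ab-xy , nz z≢w ab-zw) nonzero)

  -- If the tie is at 0 and some pair {x₀, y₀} has value 0, then {x₀, y₀} is itself a tie,
  -- and merging it against any disjoint pair {x, y} shows pairValue x y ≢ 0.
  ¬tiedMaximum : ∀ {a b} → ¬ TiedMaximum value a b
  ¬tiedMaximum {a} tie@(a≢b , _ , max) with value a ≟ 0F
  ... | no a≢0 = ¬separating a≢b (tied⇒separating tie (inj₁ a≢0))
  ... | yes a≡0 with any? (λ x → any? (λ y → ¬? (x ≟ y) ×-dec (pairValue x y ≟ 0F)))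
  ...   | no noZeroPair =
    ¬separating a≢b (tied⇒separating tie (inj₂ λ x≢y _ p≡0 → noZeroPair (_ , _ , x≢y , p≡0)))
  ...   | yes (x₀ , y₀ , x₀≢y₀ , p₀≡0) =
    ¬separating x₀≢y₀ (tied⇒separating (allZero-tied x₀≢y₀) (inj₂ onlyZeroPair))
    where
    allZero : ∀ j → value j ≡ 0F
    allZero j = ≤-antisym (subst (value j Fin.≤_) a≡0 (max j)) z≤n
    allZero-tied : ∀ {u v} → u ≢ v → TiedMaximum value u v
    allZero-tied {u} {v} u≢v = u≢v , trans (allZero v) (sym (allZero u)) ,
                               λ j → ≤-reflexive (trans (allZero j) (sym (allZero u)))
    five<2+r : 5 ℕ.< 2 + r
    five<2+r = s≤s (s≤s (ℕ.≤-trans (ℕ.m≤m+n 4 k) r-large))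
    onlyZeroPair : ∀ {x y} → x ≢ y → Disjoint x₀ y₀ x y → pairValue x y ≢ 0F
    onlyZeroPair {x} {y} x≢y disjoint p≡0
      with ∃-∉-image (ℕ.<⇒≤ five<2+r) (lookup (x₀ ∷ y₀ ∷ x ∷ y ∷ []))
    ... | u , u∉ with ∃-∉-image five<2+r (lookup (x₀ ∷ y₀ ∷ x ∷ y ∷ u ∷ []))
    ... | v , v∉ =
      proj₁ (merging-separates {u} {v} {x₀} {y₀} {x} {y} (allZero-tied (v∉ 4F)) x₀≢y₀ x≢y disjoint
               (≢-sym (u∉ 0F) , ≢-sym (u∉ 1F) , ≢-sym (v∉ 0F) , ≢-sym (v∉ 1F))
               (≢-sym (u∉ 2F) , ≢-sym (u∉ 3F) , ≢-sym (v∉ 2F) , ≢-sym (v∉ 3F)))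
            (trans p₀≡0 (sym p≡0))

  uniqueMaximum : LO (2 + k) (2 + r) value
  uniqueMaximum = [ id , (λ (_ , _ , tie) → ⊥-elim (¬tiedMaximum tie)) ]′ (LO⊎tiedMaximum value)

polymorphism-extends : ∀ {k r p} {f : Fun 2 k p} → 2 ≤ k → k + 2 ≤ r → IsPol 2 k r p f → IsPol 2 k (r + 2) p f
polymorphism-extends {suc (suc k)} {r} {p} {f} (s≤s (s≤s _)) k+2≤r pol =
  subst (λ n → IsPol 2 (2 + k) n p f) (ℕ.+-comm 2 r)
    λ M columns → Extension.uniqueMaximum f pol M (λ c → LO⇒unit (columns c)) r-large
  where
  r-large : 3 + k ℕ.< r
  r-large = subst (_≤ r) (cong (2 +_) (ℕ.+-comm k 2)) k+2≤r

theorem5p21 : (k r : ℕ) → 3 ≤ k → k + 2 ≤ r → MinionHom 2 k r (r + 2)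
theorem5p21 k r 3≤k k+2≤r =
  (λ p (f , pol) → f , polymorphism-extends {f = f} (ℕ.≤-trans (ℕ.n≤1+n 2) 3≤k) k+2≤r pol) ,
  λ _ _ _ _ _ → refl
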